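{- Let $w\in S_n$ and let $r=(r^{n-1})\cdots(r^1)\in RFC(w)$ be a highest weight factorization. For each $j$, let $r^i_j$ denote the $j$-th letter (in increasing order) of block $r^i$. Then for each $j$, \[ r^{n-1}_j>\cdots>r^2_j>r^1_j, \] where blocks with fewer than $j$ letters are omitted from the chain.
   Context: Reduced factorizations with cutoff. For $v\in S_n$, a reduced word is $a_1\cdots a_p\in[n-1]^p$ with $v=s_{a_1}\cdots s_{a_p}$ and $p=\ell(v)$, where $s_k=(k,k+1)$. $RFC(v)$ is the set of reduced words for $v$ divided into $n-1$ consecutive, possibly empty, blocks $r=(r^{n-1})\cdots(r^1)$, numbered right to left, such that letters strictly increase within each block and the leftmost letter of each nonempty block $r^i$ is at least $i$. Pairing on block $i$. The letters of $r^i$ are considered from largest to smallest. A letter $a$ is paired with the smallest not-yet-paired letter $b$ of $r^{i+1}$ with $a<b$, if one exists; otherwise $a$ is unpaired. Letters of $r^{i+1}$ never paired are unpaired. Raising operator $e_i$. If all letters of $r^{i+1}$ are paired, set $e_i(r)=0$. Otherwise let $v$ be the largest unpaired letter of $r^{i+1}$ and $s=\min\{z\ge v: z+1\notin r^{i+1}\}$. Let $e_i(r)$ be obtained by removing $v$ from $r^{i+1}$ and inserting $s$ into $r^i$. If this result is not in $RFC(w)$, set $e_i(r)=0$. $r$ is a highest weight factorization if $e_i(r)=0$ for all $1\le i<n$. -}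

module Defs where

open import Data.Nat using (ℕ; zero; suc; _+_; _∸_; _≤_; _<_; _<?_; _≡ᵇ_; _<ᵇ_)
open import Data.Bool using (Bool; true; false; if_then_else_)
open import Data.List using (List; []; _∷_; length; reverse; concat; foldl; filterᵇ)
open import Data.Bool.ListAction using (any)
open import Data.List.Relation.Unary.All using (All)
open import Data.Maybe using (Maybe; just; nothing)
open import Data.Fin using (Fin; toℕ; fromℕ<)
open import Data.Fin.Permutation using (Permutation′; _⟨$⟩ʳ_)
open import Data.Product using (_×_; Σ)
open import Relation.Binary.PropositionalEquality using (_≡_)
open import Relation.Nullary using (¬_; yes; no)

-- Letters / positions are 1-indexed natural numbers; s_k = (k, k+1).

swap : ℕ → ℕ → ℕ
swap a x = if x ≡ᵇ a then suc a else (if x ≡ᵇ suc a then a else x)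

act : List ℕ → ℕ → ℕ
act [] x = x
act (a ∷ as) x = swap a (act as x)

-- a permutation w ∈ S_n seen as a map on {1,…,n} (identity outside)
permℕ : (n : ℕ) → Permutation′ n → ℕ → ℕ
permℕ n w zero = zero
permℕ n w (suc x) with x <? n
... | yes x<n = suc (toℕ (w ⟨$⟩ʳ fromℕ< x<n))
... | no _ = suc x

countFrom : (ℕ → ℕ) → ℕ → ℕ → ℕ
countFrom f i zero = 0
countFrom f i (suc k) =
  (if f (i + suc k) <ᵇ f i then 1 else 0) + countFrom f i k

inversionsUpTo : (ℕ → ℕ) → ℕ → ℕ → ℕ
inversionsUpTo f n zero = 0
inversionsUpTo f n (suc i) = countFrom f (suc i) (n ∸ suc i) + inversionsUpTo f n i

ℓ : (n : ℕ) → Permutation′ n → ℕ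
ℓ n w = inversionsUpTo (permℕ n w) n n

ReducedWord : (n : ℕ) → Permutation′ n → List ℕ → Set
ReducedWord n w word =
  All (λ a → 1 ≤ a × a < n) word ×
  (∀ x → act word x ≡ permℕ n w x) ×
  length word ≡ ℓ n w

-- A factorization is a list of blocks [r¹, r², …, r^{n-1}] (note: listed
-- from block 1 upward; it is displayed as (r^{n-1})⋯(r¹)).
Fact : Set
Fact = List (List ℕ)

nth : {A : Set} → List A → ℕ → Maybe A
nth [] _ = nothing
nth (x ∷ xs) zero = just x
nth (x ∷ xs) (suc k) = nth xs k

-- block r^i (i ≥ 1); empty if out of range
blk : Fact → ℕ → List ℕ
blk r zero = []
blk r (suc i) with nth r i
... | just b = b
... | nothing = []

wordOf : Fact → List ℕ
wordOf r = concat (reverse r)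

data StrictlyIncreasing : List ℕ → Set where
  []  : StrictlyIncreasing []
  [_] : ∀ a → StrictlyIncreasing (a ∷ [])
  _∷_ : ∀ {a b bs} → a < b → StrictlyIncreasing (b ∷ bs) → StrictlyIncreasing (a ∷ b ∷ bs)

RFC : (n : ℕ) → Permutation′ n → Fact → Set
RFC n w r =
  length r ≡ n ∸ 1 ×
  (∀ i → StrictlyIncreasing (blk r i)) ×
  (∀ i a → nth (blk r i) 0 ≡ just a → i ≤ a) ×
  ReducedWord n w (wordOf r)

removeFirstGt : ℕ → List ℕ → List ℕ
removeFirstGt a [] = []
removeFirstGt a (b ∷ bs) = if a <ᵇ b then bs else b ∷ removeFirstGt a bs

-- unpaired letters of `upper` (= r^{i+1}) when pairing with `lower` (= r^i):
-- letters of lower are processed from largest to smallest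
unpaired : List ℕ → List ℕ → List ℕ
unpaired lower upper = foldl (λ avail a → removeFirstGt a avail) upper (reverse lower)

maxMaybe : List ℕ → Maybe ℕ
maxMaybe [] = nothing
maxMaybe (x ∷ xs) with maxMaybe xs
... | nothing = just x
... | just m = just (if m <ᵇ x then x else m)

_∈ᵇ_ : ℕ → List ℕ → Bool
z ∈ᵇ bs = any (λ b → b ≡ᵇ z) bs

-- climb fuel bs z = min { z' ≥ z : z'+1 ∉ bs }, given enough fuel (length bs suffices)
climb : ℕ → List ℕ → ℕ → ℕ
climb zero bs z = z
climb (suc k) bs z = if suc z ∈ᵇ bs then climb k bs (suc z) else z

removeVal : ℕ → List ℕ → List ℕ
removeVal v bs = filterᵇ (λ b → Data.Bool.not (b ≡ᵇ v)) bs

insertSorted : ℕ → List ℕ → List ℕ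
insertSorted s [] = s ∷ []
insertSorted s (b ∷ bs) = if b <ᵇ s then b ∷ insertSorted s bs else s ∷ b ∷ bs

setNth : {A : Set} → ℕ → A → List A → List A
setNth k a [] = []
setNth zero a (x ∷ xs) = a ∷ xs
setNth (suc k) a (x ∷ xs) = x ∷ setNth k a xs

-- candidate for e_i(r) before the RFC(w)-membership check;
-- nothing means all letters of r^{i+1} are paired (e_i(r) = 0)
raiseCand : Fact → ℕ → Maybe Fact
raiseCand r i with maxMaybe (unpaired (blk r i) (blk r (suc i)))
... | nothing = nothing
... | just v =
  let up = blk r (suc i)
      s  = climb (length up) up v
  in just (setNth (i ∸ 1) (insertSorted s (blk r i)) (setNth i (removeVal v up) r))

RaiseNonzero : (n : ℕ) → Permutation′ n → Fact → ℕ → Set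
RaiseNonzero n w r i = Σ Fact (λ r' → raiseCand r i ≡ just r' × RFC n w r')

HighestWeight : (n : ℕ) → Permutation′ n → Fact → Set
HighestWeight n w r = ∀ i → 1 ≤ i → i < n → ¬ RaiseNonzero n w r i

{-# OPTIONS --safe #-}

-- Write L = r^i and U = r^{i+1}. If some letter of U is unpaired, let v be the largest one and
-- s = min {z ≥ v : z+1 ∉ U}, so that U contains v, v+1, …, s. Maximality of v forces v, …, s−1 ∈ L
-- and v−1 ∉ L, so the letters of L below v commute with v, …, s, and the braid relations give
--   (v ⋯ s)(v ⋯ s−1) = (v+1 ⋯ s)(v ⋯ s)   and   (v ⋯ s)(v ⋯ s) = (v+1 ⋯ s)(v ⋯ s−1).
-- If s ∈ L the second identity shortens the reduced word of w, which is impossible; otherwise the first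
-- shows that moving v out of U and s into L yields a factorization in RFC(w), i.e. e_i(r) ≠ 0.
-- Hence in a highest weight factorization every letter of r^{i+1} is paired with a smaller letter of r^i.
-- The j smallest letters of r^{i+1} are then paired with j distinct letters of r^i below the j-th of them,
-- so the j-th letter of r^i is the smaller one; chaining over i gives the statement.

module Submission where

open import Data.Bool using (Bool; true; false; T; not; _∧_; if_then_else_)
open import Data.Bool.Properties using (T-∧)
open import Data.Empty using (⊥-elim)
open import Data.Fin.Permutation using (Permutation′)
open import Data.List using (List; []; _∷_; _++_; _∷ʳ_; length; reverse; concat; foldl)
open import Data.List.Membership.Propositional using (_∈_; _∉_)
open import Data.List.Membership.Propositional.Properties using (∈-++⁺ˡ; ∈-++⁺ʳ; ∈-++⁻; ∈-∃++; ∈-filter⁻)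
open import Data.List.Properties
  using (length-++; length-++-sucʳ; unfold-reverse; reverse-++; reverse-involutive; concat-++; ++-assoc; ++-identityʳ)
open import Data.List.Relation.Binary.Prefix.Heterogeneous using (Prefix; []; _∷_; _++ᵖ_)
open import Data.List.Relation.Binary.Prefix.Heterogeneous.Properties using (length-mono)
open import Data.List.Relation.Binary.Subset.Propositional using (_⊆_)
import Data.List.Relation.Binary.Subset.Propositional.Properties as Subset
open import Data.List.Relation.Unary.All using (All; []; _∷_)
import Data.List.Relation.Unary.All as All
import Data.List.Relation.Unary.All.Properties as All
open import Data.List.Relation.Unary.AllPairs using (AllPairs; []; _∷_)
import Data.List.Relation.Unary.AllPairs as AllPairs
import Data.List.Relation.Unary.AllPairs.Properties as AllPairsₚ
open import Data.List.Relation.Unary.Any using (here; there)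
import Data.List.Relation.Unary.Any.Properties as Any
open import Data.Maybe using (just; nothing)
open import Data.Maybe.Properties using (just-injective)
open import Data.Nat
open import Data.Nat.Properties
open import Data.Product using (_×_; _,_; ∃; ∃₂; proj₁; proj₂)
open import Data.Sum using (_⊎_; inj₁; inj₂)
open import Data.Unit using (tt)
open import Function using (_∘_; Equivalence)
open import Function.Definitions using (Injective)
open import Relation.Binary.PropositionalEquality
open import Relation.Nullary using (¬_; yes; no; proof)
open import Relation.Nullary.Decidable using (dec-true; dec-false; T?)
open import Relation.Nullary.Reflects using (Reflects; ofʸ; ofⁿ)

open import Data.List.Membership.DecPropositional _≟_ using (_∈?_)
open import Algebra.Properties.CommutativeSemigroup +-commutativeSemigroup using (interchange; x∙yz≈y∙xz)

open import Defs

<ᵇ-true : ∀ {m n} → m < n → (m <ᵇ n) ≡ true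
<ᵇ-true {m} {n} = dec-true (m <? n)

<ᵇ-false : ∀ {m n} → m ≮ n → (m <ᵇ n) ≡ false
<ᵇ-false {m} {n} = dec-false (m <? n)

≡ᵇ-true : ∀ {m n} → m ≡ n → (m ≡ᵇ n) ≡ true
≡ᵇ-true {m} {n} = dec-true (m ≟ n)

≡ᵇ-false : ∀ {m n} → m ≢ n → (m ≡ᵇ n) ≡ false
≡ᵇ-false {m} {n} = dec-false (m ≟ n)

≡ᵇ-reflects-≡ : ∀ m n → Reflects (m ≡ n) (m ≡ᵇ n)
≡ᵇ-reflects-≡ m n = proof (m ≟ n)

-- Simple transpositions

data Position (a x : ℕ) : Set where
  at-a   : x ≡ a → Position a x
  at-1+a : x ≡ suc a → Position a x
  away   : x ≢ a → x ≢ suc a → Position a x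

position : ∀ a x → Position a x
position a x with x ≟ a | x ≟ suc a
... | yes x≡a | _         = at-a x≡a
... | no _    | yes x≡1+a = at-1+a x≡1+a
... | no x≢a  | no x≢1+a  = away x≢a x≢1+a

swap-a : ∀ a → swap a a ≡ suc a
swap-a a rewrite ≡ᵇ-true {a} refl = refl

swap-1+a : ∀ a → swap a (suc a) ≡ a
swap-1+a a rewrite ≡ᵇ-false (1+n≢n {a}) | ≡ᵇ-true {suc a} refl = refl

swap-away : ∀ {a x} → x ≢ a → x ≢ suc a → swap a x ≡ x
swap-away x≢a x≢1+a rewrite ≡ᵇ-false x≢a | ≡ᵇ-false x≢1+a = refl

swap-< : ∀ {a x} → x < a → swap a x ≡ x
swap-< x<a = swap-away (<⇒≢ x<a) (<⇒≢ (m<n⇒m<1+n x<a))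

swap-> : ∀ {a x} → suc a < x → swap a x ≡ x
swap-> 1+a<x = swap-away (>⇒≢ (<-trans (n<1+n _) 1+a<x)) (>⇒≢ 1+a<x)

swap-involutive : ∀ a x → swap a (swap a x) ≡ x
swap-involutive a x with position a x
... | at-a refl           = trans (cong (swap a) (swap-a a)) (swap-1+a a)
... | at-1+a refl         = trans (cong (swap a) (swap-1+a a)) (swap-a a)
... | away x≢a x≢1+a rewrite swap-away x≢a x≢1+a = swap-away x≢a x≢1+a

swap-injective : ∀ a {x y} → swap a x ≡ swap a y → x ≡ y
swap-injective a {x} {y} eq =
  trans (sym (swap-involutive a x)) (trans (cong (swap a) eq) (swap-involutive a y))

swap-braid : ∀ a x → swap a (swap (suc a) (swap a x)) ≡ swap (suc a) (swap a (swap (suc a) x))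
swap-braid a x with position a x
... | at-a refl rewrite swap-a a | swap-a (suc a) | swap-> {a} (≤-refl {suc (suc a)})
                      | swap-< {suc a} (n<1+n a) | swap-a a | swap-a (suc a) = refl
... | at-1+a refl rewrite swap-1+a a | swap-< {suc a} (n<1+n a) | swap-a a
                        | swap-a (suc a) | swap-> {a} (≤-refl {suc (suc a)}) | swap-1+a (suc a) = refl
... | away x≢a x≢1+a with position (suc a) x
...   | at-a x≡1+a = ⊥-elim (x≢1+a x≡1+a)
...   | at-1+a refl rewrite swap-> {a} (≤-refl {suc (suc a)}) | swap-1+a (suc a) | swap-1+a a
                          | swap-< {suc a} (n<1+n a) = refl
...   | away x≢1+a′ x≢2+a rewrite swap-away x≢a x≢1+a | swap-away x≢1+a′ x≢2+a
                                | swap-away x≢a x≢1+a | swap-away x≢1+a′ x≢2+a = refl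

swap-comm-< : ∀ {a b} x → suc (suc a) ≤ b → swap a (swap b x) ≡ swap b (swap a x)
swap-comm-< {a} {b} x a+2≤b with position a x
... | at-a refl   rewrite swap-< {b} (<-trans (n<1+n x) a+2≤b) | swap-a x = sym (swap-< a+2≤b)
... | at-1+a refl rewrite swap-< a+2≤b | swap-1+a a = sym (swap-< (<-trans (n<1+n a) a+2≤b))
... | away x≢a x≢1+a with position b x
...   | at-a refl   rewrite swap-a x | swap-away x≢a x≢1+a | swap-a x =
                        swap-> (<-trans a+2≤b (n<1+n x))
...   | at-1+a refl rewrite swap-1+a b | swap-away x≢a x≢1+a | swap-1+a b = swap-> a+2≤b
...   | away x≢b x≢1+b rewrite swap-away x≢b x≢1+b | swap-away x≢a x≢1+a = sym (swap-away x≢b x≢1+b)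

Distant : ℕ → ℕ → Set
Distant a b = suc (suc a) ≤ b ⊎ suc (suc b) ≤ a

swap-comm : ∀ {a b} x → Distant a b → swap a (swap b x) ≡ swap b (swap a x)
swap-comm x (inj₁ a+2≤b) = swap-comm-< x a+2≤b
swap-comm x (inj₂ b+2≤a) = sym (swap-comm-< x b+2≤a)

swap-<-swap : ∀ a {x y} → swap a y < swap a x → y < x ⊎ (x ≡ a × y ≡ suc a)
swap-<-swap a {x} {y} lt with position a x | position a y
... | at-a refl   | at-a refl   = ⊥-elim (<-irrefl refl lt)
... | at-a refl   | at-1+a refl = inj₂ (refl , refl)
... | at-a refl   | away y≢a y≢1+a rewrite swap-a x | swap-away y≢a y≢1+a =
  inj₁ (≤∧≢⇒< (≤-pred lt) y≢a)
... | at-1+a refl | at-a refl   rewrite swap-1+a a | swap-a a = ⊥-elim (<-asym lt (n<1+n a))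
... | at-1+a refl | at-1+a refl = ⊥-elim (<-irrefl refl lt)
... | at-1+a refl | away y≢a y≢1+a rewrite swap-1+a a | swap-away y≢a y≢1+a = inj₁ (<-trans lt (n<1+n a))
... | away x≢a x≢1+a | at-a refl   rewrite swap-away x≢a x≢1+a | swap-a y = inj₁ (<-trans (n<1+n y) lt)
... | away x≢a x≢1+a | at-1+a refl rewrite swap-away x≢a x≢1+a | swap-1+a a =
  inj₁ (≤∧≢⇒< lt (x≢1+a ∘ sym))
... | away x≢a x≢1+a | away y≢a y≢1+a rewrite swap-away x≢a x≢1+a | swap-away y≢a y≢1+a = inj₁ lt

-- Words acting on ℕ

act-++ : ∀ xs ys x → act (xs ++ ys) x ≡ act xs (act ys x)
act-++ []       ys x = refl
act-++ (a ∷ xs) ys x = cong (swap a) (act-++ xs ys x)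

act-injective : ∀ ws → Injective _≡_ _≡_ (act ws)
act-injective []       eq = eq
act-injective (a ∷ ws) eq = act-injective ws (swap-injective a eq)

swap-act-comm : ∀ {a} ws x → All (Distant a) ws → swap a (act ws x) ≡ act ws (swap a x)
swap-act-comm []       x []           = refl
swap-act-comm (b ∷ ws) x (a⋯b ∷ a⋯ws) =
  trans (swap-comm (act ws x) a⋯b) (cong (swap b) (swap-act-comm ws x a⋯ws))

act-comm : ∀ us ws x → All (λ a → All (Distant a) ws) us → act us (act ws x) ≡ act ws (act us x)
act-comm []       ws x []             = refl
act-comm (a ∷ us) ws x (a⋯ws ∷ us⋯ws) =
  trans (cong (swap a) (act-comm us ws x us⋯ws)) (swap-act-comm ws (act us x) a⋯ws)

Distant-blocks : ∀ {v V B} → All (v ≤_) V → All (λ a → suc a < v) B → All (λ b → All (Distant b) B) V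
Distant-blocks v≤V 1+B<v = All.map (λ v≤b → All.map (λ 1+a<v → inj₂ (≤-trans 1+a<v v≤b)) 1+B<v) v≤V

act-++-∷ : ∀ {a} U L x → All (Distant a) U → act (U ++ a ∷ L) x ≡ swap a (act (U ++ L) x)
act-++-∷ {a} U L x U⋯a = begin
  act (U ++ a ∷ L) x          ≡⟨ act-++ U (a ∷ L) x ⟩
  act U (swap a (act L x))    ≡⟨ swap-act-comm U (act L x) U⋯a ⟨
  swap a (act U (act L x))    ≡⟨ cong (swap a) (act-++ U L x) ⟨
  swap a (act (U ++ L) x)     ∎
  where open ≡-Reasoning

act-++-congˡ : ∀ X {Y Z} → act Y ≗ act Z → act (X ++ Y) ≗ act (X ++ Z)
act-++-congˡ X {Y} {Z} act≗ x = trans (act-++ X Y x) (trans (cong (act X) (act≗ x)) (sym (act-++ X Z x)))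

act-++-congʳ : ∀ {Y Z} W → act Y ≗ act Z → act (Y ++ W) ≗ act (Z ++ W)
act-++-congʳ {Y} {Z} W act≗ x = trans (act-++ Y W x) (trans (act≗ (act W x)) (sym (act-++ Z W x)))

infix 4 _≃_

record _≃_ (Y Z : List ℕ) : Set where
  constructor mk≃
  field
    act≗    : act Y ≗ act Z
    length≡ : length Y ≡ length Z

≃-reflexive : ∀ {Y Z} → Y ≡ Z → Y ≃ Z
≃-reflexive refl = mk≃ (λ _ → refl) refl

≃-sym : ∀ {Y Z} → Y ≃ Z → Z ≃ Y
≃-sym (mk≃ act≗ length≡) = mk≃ (sym ∘ act≗) (sym length≡)

≃-trans : ∀ {X Y Z} → X ≃ Y → Y ≃ Z → X ≃ Z
≃-trans (mk≃ act≗ length≡) (mk≃ act≗′ length≡′) = mk≃ (λ x → trans (act≗ x) (act≗′ x)) (trans length≡ length≡′)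

≃-++ˡ : ∀ X {Y Z} → Y ≃ Z → X ++ Y ≃ X ++ Z
≃-++ˡ X (mk≃ act≗ length≡) =
  mk≃ (act-++-congˡ X act≗) (trans (length-++ X) (trans (cong (length X +_) length≡) (sym (length-++ X))))

≃-++ʳ : ∀ {Y Z} W → Y ≃ Z → Y ++ W ≃ Z ++ W
≃-++ʳ {Y} {Z} W (mk≃ act≗ length≡) =
  mk≃ (act-++-congʳ {Y} {Z} W act≗) (trans (length-++ Y) (trans (cong (_+ length W) length≡) (sym (length-++ Z))))

commute-blocks : ∀ A V B W → All (λ b → All (Distant b) B) V → (A ++ V) ++ B ++ W ≃ A ++ B ++ V ++ W
commute-blocks A V B W V⋯B =
  ≃-trans (≃-reflexive (++-assoc A V (B ++ W))) (≃-++ˡ A (mk≃ act-swap length-swap))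
  where
  act-swap : act (V ++ B ++ W) ≗ act (B ++ V ++ W)
  act-swap x = begin
    act (V ++ B ++ W) x        ≡⟨ act-++ V (B ++ W) x ⟩
    act V (act (B ++ W) x)     ≡⟨ cong (act V) (act-++ B W x) ⟩
    act V (act B (act W x))    ≡⟨ act-comm V B (act W x) V⋯B ⟩
    act B (act V (act W x))    ≡⟨ cong (act B) (act-++ V W x) ⟨
    act B (act (V ++ W) x)     ≡⟨ act-++ B (V ++ W) x ⟨
    act (B ++ V ++ W) x        ∎
    where open ≡-Reasoning
  length-swap : length (V ++ B ++ W) ≡ length (B ++ V ++ W)
  length-swap = begin
    length (V ++ B ++ W)                   ≡⟨ length-++ V ⟩
    length V + length (B ++ W)             ≡⟨ cong (length V +_) (length-++ B) ⟩
    length V + (length B + length W)       ≡⟨ x∙yz≈y∙xz (length V) (length B) (length W) ⟩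
    length B + (length V + length W)       ≡⟨ cong (length B +_) (length-++ V) ⟨
    length B + length (V ++ W)             ≡⟨ length-++ B ⟨
    length (B ++ V ++ W)                   ∎
    where open ≡-Reasoning

NonReduced : List ℕ → Set
NonReduced Y = ∃ λ Z → act Z ≗ act Y × length Z < length Y

NonReduced-++ˡ : ∀ X {Y} → NonReduced Y → NonReduced (X ++ Y)
NonReduced-++ˡ X {Y} (Z , act≗ , shorter) =
  X ++ Z , act-++-congˡ X act≗ ,
  subst₂ _<_ (sym (length-++ X)) (sym (length-++ X)) (+-monoʳ-< (length X) shorter)

NonReduced-++ʳ : ∀ {Y} W → NonReduced Y → NonReduced (Y ++ W)
NonReduced-++ʳ {Y} W (Z , act≗ , shorter) =
  Z ++ W , act-++-congʳ {Z} {Y} W act≗ ,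
  subst₂ _<_ (sym (length-++ Z)) (sym (length-++ Y)) (+-monoˡ-< (length W) shorter)

NonReduced-≃ : ∀ {Y Y′} → Y ≃ Y′ → NonReduced Y → NonReduced Y′
NonReduced-≃ (mk≃ act≗ length≡) (Z , act≗′ , shorter) =
  Z , (λ x → trans (act≗′ x) (act≗ x)) , subst (_ <_) length≡ shorter

-- Inversions

indicator : Bool → ℕ
indicator b = if b then 1 else 0

count : (ℕ → Bool) → ℕ → ℕ
count p zero    = 0
count p (suc k) = indicator (p (suc k)) + count p k

count-none : ∀ p k → (∀ {t} → t ≤ k → ¬ T (p t)) → count p k ≡ 0
count-none p zero    never = refl
count-none p (suc k) never with p (suc k) in eq
... | true  = ⊥-elim (never ≤-refl (subst T (sym eq) tt))
... | false = count-none p k (never ∘ m≤n⇒m≤1+n)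

count-unique : ∀ p k → (∀ {x y} → T (p x) → T (p y) → x ≡ y) → count p k ≤ 1
count-unique p zero    unique = z≤n
count-unique p (suc k) unique with p (suc k) in eq
... | false = count-unique p k unique
... | true  = ≤-reflexive (cong suc (count-none p k
                (λ t≤k pt → <-irrefl (unique pt (subst T (sym eq) tt)) (s≤s t≤k))))

count-⊎ : ∀ p q r k → (∀ t → T (p t) → T (q t) ⊎ T (r t)) → count p k ≤ count q k + count r k
count-⊎ p q r zero    split = z≤n
count-⊎ p q r (suc k) split =
  ≤-trans (+-mono-≤ (indicator-⊎ (split (suc k))) (count-⊎ p q r k split))
          (≤-reflexive (interchange (indicator (q (suc k))) (indicator (r (suc k))) (count q k) (count r k)))
  where
  indicator-⊎ : ∀ {b c d} → (T b → T c ⊎ T d) → indicator b ≤ indicator c + indicator d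
  indicator-⊎ {false}                  _     = z≤n
  indicator-⊎ {true}  {true}           _     = s≤s z≤n
  indicator-⊎ {true}  {false} {true}   _     = s≤s z≤n
  indicator-⊎ {true}  {false} {false}  split with split tt
  ... | inj₁ ()
  ... | inj₂ ()

countFrom≡count : ∀ f i k → countFrom f i k ≡ count (λ t → f (i + t) <ᵇ f i) k
countFrom≡count f i zero    = refl
countFrom≡count f i (suc k) = cong (indicator (f (i + suc k) <ᵇ f i) +_) (countFrom≡count f i k)

countFrom-cong : ∀ {f g} i k → f ≗ g → countFrom f i k ≡ countFrom g i k
countFrom-cong         i zero    f≗g = refl
countFrom-cong {f} {g} i (suc k) f≗g
  rewrite f≗g (i + suc k) | f≗g i = cong (indicator (g (i + suc k) <ᵇ g i) +_) (countFrom-cong i k f≗g)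

inversions-cong : ∀ {f g} n m → f ≗ g → inversionsUpTo f n m ≡ inversionsUpTo g n m
inversions-cong n zero    f≗g = refl
inversions-cong n (suc m) f≗g =
  cong₂ _+_ (countFrom-cong (suc m) (n ∸ suc m) f≗g) (inversions-cong n m f≗g)

countFrom-swap : ∀ f a i k → Injective _≡_ _≡_ f →
  countFrom (swap a ∘ f) i k ≤ countFrom f i k + indicator (f i ≡ᵇ a)
countFrom-swap f a i k f-inj = begin
  countFrom (swap a ∘ f) i k                        ≡⟨ countFrom≡count (swap a ∘ f) i k ⟩
  count (λ t → swap a (f (i + t)) <ᵇ swap a (f i)) k ≤⟨ count-⊎ _ _ _ k new-inversion ⟩
  count old k + count (λ t → (f i ≡ᵇ a) ∧ (f (i + t) ≡ᵇ suc a)) k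
                                                    ≤⟨ +-monoʳ-≤ (count old k) at-most-one ⟩
  count old k + indicator (f i ≡ᵇ a)                ≡⟨ cong (_+ _) (countFrom≡count f i k) ⟨
  countFrom f i k + indicator (f i ≡ᵇ a)            ∎
  where
  open ≤-Reasoning
  old : ℕ → Bool
  old t = f (i + t) <ᵇ f i
  new-inversion : ∀ t → T (swap a (f (i + t)) <ᵇ swap a (f i)) →
                  T (old t) ⊎ T ((f i ≡ᵇ a) ∧ (f (i + t) ≡ᵇ suc a))
  new-inversion t lt with swap-<-swap a {f i} {f (i + t)} (<ᵇ⇒< _ _ lt)
  ... | inj₁ lt′            = inj₁ (<⇒<ᵇ lt′)
  ... | inj₂ (fi≡a , ft≡1+a) = inj₂ (Equivalence.from T-∧ (≡⇒≡ᵇ _ _ fi≡a , ≡⇒≡ᵇ _ _ ft≡1+a))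
  at-most-one : count (λ t → (f i ≡ᵇ a) ∧ (f (i + t) ≡ᵇ suc a)) k ≤ indicator (f i ≡ᵇ a)
  at-most-one with f i ≡ᵇ a
  ... | false = ≤-reflexive (count-none _ k (λ _ ()))
  ... | true  = count-unique _ k (λ {x} {y} px py →
                  +-cancelˡ-≡ i x y (f-inj (trans (≡ᵇ⇒≡ _ _ px) (sym (≡ᵇ⇒≡ _ _ py)))))

inversions-swap : ∀ f a n m → Injective _≡_ _≡_ f →
  inversionsUpTo (swap a ∘ f) n m ≤ inversionsUpTo f n m + count (λ i → f i ≡ᵇ a) m
inversions-swap f a n zero    f-inj = z≤n
inversions-swap f a n (suc m) f-inj =
  ≤-trans (+-mono-≤ (countFrom-swap f a (suc m) (n ∸ suc m) f-inj) (inversions-swap f a n m f-inj))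
          (≤-reflexive (interchange (countFrom f (suc m) (n ∸ suc m)) (indicator (f (suc m) ≡ᵇ a))
                                    (inversionsUpTo f n m) (count (λ i → f i ≡ᵇ a) m)))

inversions-id : ∀ n m → inversionsUpTo (λ x → x) n m ≡ 0
inversions-id n zero    = refl
inversions-id n (suc m) = cong₂ _+_ (no-inversion (n ∸ suc m)) (inversions-id n m)
  where
  no-inversion : ∀ k → countFrom (λ x → x) (suc m) k ≡ 0
  no-inversion zero    = refl
  no-inversion (suc k) rewrite <ᵇ-false (<⇒≯ (m<m+n (suc m) {suc k} z<s)) = no-inversion k

inversions-act≤length : ∀ ws n m → inversionsUpTo (act ws) n m ≤ length ws
inversions-act≤length []       n m = ≤-reflexive (inversions-id n m)
inversions-act≤length (a ∷ ws) n m = begin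
  inversionsUpTo (swap a ∘ act ws) n m                           ≤⟨ inversions-swap (act ws) a n m (act-injective ws) ⟩
  inversionsUpTo (act ws) n m + count (λ i → act ws i ≡ᵇ a) m     ≤⟨ +-mono-≤ (inversions-act≤length ws n m) a-once ⟩
  length ws + 1                                                  ≡⟨ +-comm (length ws) 1 ⟩
  suc (length ws)                                                ∎
  where
  open ≤-Reasoning
  a-once : count (λ i → act ws i ≡ᵇ a) m ≤ 1
  a-once = count-unique _ m (λ px py → act-injective ws (trans (≡ᵇ⇒≡ _ _ px) (sym (≡ᵇ⇒≡ _ _ py))))

ℓ≤length : ∀ n (w : Permutation′ n) ws → act ws ≗ permℕ n w → ℓ n w ≤ length ws
ℓ≤length n w ws act≗w = subst (_≤ length ws) (inversions-cong n n act≗w) (inversions-act≤length ws n n)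

ReducedWord⇒¬NonReduced : ∀ {n w ws} → ReducedWord n w ws → ¬ NonReduced ws
ReducedWord⇒¬NonReduced {n} {w} (_ , act≗w , length≡ℓ) (Z , act≗ , shorter) =
  <⇒≱ (subst (length Z <_) length≡ℓ shorter) (ℓ≤length n w Z (λ x → trans (act≗ x) (act≗w x)))

ReducedWord-≃ : ∀ {n w ws ws′} → ReducedWord n w ws → ws′ ⊆ ws → ws′ ≃ ws → ReducedWord n w ws′
ReducedWord-≃ (inRange , act≗w , length≡ℓ) ws′⊆ws (mk≃ act≗ length≡) =
  All.anti-mono ws′⊆ws inRange , (λ x → trans (act≗ x) (act≗w x)) , trans length≡ length≡ℓ

-- Increasing words

Increasing : List ℕ → Set
Increasing = AllPairs _<_

Decreasing : List ℕ → Set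
Decreasing = AllPairs _>_

StrictlyIncreasing⇒Increasing : ∀ {xs} → StrictlyIncreasing xs → Increasing xs
StrictlyIncreasing⇒Increasing []              = []
StrictlyIncreasing⇒Increasing [ a ]           = [] ∷ []
StrictlyIncreasing⇒Increasing (a<b ∷ b∷bs↑) with StrictlyIncreasing⇒Increasing b∷bs↑
... | b<bs ∷ bs↑ = (a<b ∷ All.map (<-trans a<b) b<bs) ∷ b<bs ∷ bs↑

Increasing⇒StrictlyIncreasing : ∀ xs → Increasing xs → StrictlyIncreasing xs
Increasing⇒StrictlyIncreasing []           _                   = []
Increasing⇒StrictlyIncreasing (a ∷ [])     _                   = [ a ]
Increasing⇒StrictlyIncreasing (a ∷ b ∷ bs) ((a<b ∷ _) ∷ b∷bs↑) = a<b ∷ Increasing⇒StrictlyIncreasing (b ∷ bs) b∷bs↑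

Increasing-head≤ : ∀ {b bs y} → Increasing (b ∷ bs) → y ∈ b ∷ bs → b ≤ y
Increasing-head≤ _            (here refl) = ≤-refl
Increasing-head≤ (b<bs ∷ _)   (there y∈)  = <⇒≤ (All.lookup b<bs y∈)

least∈⇒head : ∀ {c} xs → Increasing xs → All (c ≤_) xs → c ∈ xs → ∃ λ ys → xs ≡ c ∷ ys
least∈⇒head (b ∷ bs) ↑ (c≤b ∷ _) c∈ = bs , cong (_∷ bs) (≤-antisym (Increasing-head≤ ↑ c∈) c≤b)

head≥⇒All≥ : ∀ {c L} → Increasing L → (∀ a → nth L 0 ≡ just a → c ≤ a) → All (c ≤_) L
head≥⇒All≥ {L = []}    _           _     = []
head≥⇒All≥ {L = b ∷ bs} (b<bs ∷ _) c≤hd =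
  c≤hd b refl ∷ All.map (λ b<x → <⇒≤ (≤-<-trans (c≤hd b refl) b<x)) b<bs

All≥⇒head≥ : ∀ {c L} → All (c ≤_) L → ∀ a → nth L 0 ≡ just a → c ≤ a
All≥⇒head≥ (c≤a ∷ _) a refl = c≤a

Increasing-reverse : ∀ {xs} → Increasing xs → Decreasing (reverse xs)
Increasing-reverse {[]}     []          = []
Increasing-reverse {x ∷ xs} (x<xs ∷ ↑) rewrite unfold-reverse x xs =
  AllPairsₚ.++⁺ (Increasing-reverse ↑) ([] ∷ [])
    (All.tabulate (λ y∈ → All.lookup x<xs (Any.reverse⁻ y∈) ∷ []))

Increasing-around : ∀ P {v Q} → Increasing (P ++ v ∷ Q) → All (_< v) P × All (v <_) Q
Increasing-around []      (v<Q ∷ _)     = [] , v<Q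
Increasing-around (p ∷ P) (p<rest ∷ ↑) =
  All.lookup p<rest (∈-++⁺ʳ P (here refl)) ∷ proj₁ (Increasing-around P ↑) , proj₂ (Increasing-around P ↑)

Increasing-++⁻ʳ : ∀ P {Q} → Increasing (P ++ Q) → Increasing Q
Increasing-++⁻ʳ []      ↑       = ↑
Increasing-++⁻ʳ (_ ∷ P) (_ ∷ ↑) = Increasing-++⁻ʳ P ↑

∈-tail : ∀ {y b : ℕ} {bs} → y ∈ b ∷ bs → y ≢ b → y ∈ bs
∈-tail (here y≡b) y≢b = ⊥-elim (y≢b y≡b)
∈-tail (there y∈) _   = y∈

∈-++-≥ : ∀ P {Q c y} → All (_< c) P → c ≤ y → y ∈ P ++ Q → y ∈ Q
∈-++-≥ P P<c c≤y y∈ with ∈-++⁻ P y∈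
... | inj₁ y∈P = ⊥-elim (<⇒≱ (All.lookup P<c y∈P) c≤y)
... | inj₂ y∈Q = y∈Q

splitBelow : ∀ c {xs} → Increasing xs → ∃₂ λ P S → xs ≡ P ++ S × All (_< c) P × All (c ≤_) S
splitBelow c {[]}     []           = [] , [] , refl , [] , []
splitBelow c {b ∷ bs} (b<bs ∷ bs↑) with b <? c
... | yes b<c = let (P , S , eq , P<c , c≤S) = splitBelow c bs↑ in b ∷ P , S , cong (b ∷_) eq , b<c ∷ P<c , c≤S
... | no  b≮c = [] , b ∷ bs , refl , [] , ≮⇒≥ b≮c ∷ All.map (λ b<x → <⇒≤ (≤-<-trans (≮⇒≥ b≮c) b<x)) b<bs

length-insertSorted : ∀ s L → length (insertSorted s L) ≡ suc (length L)
length-insertSorted s []       = refl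
length-insertSorted s (b ∷ bs) with b <ᵇ s
... | true  = cong suc (length-insertSorted s bs)
... | false = refl

length-++-insertSorted : ∀ U s L → length (U ++ insertSorted s L) ≡ suc (length (U ++ L))
length-++-insertSorted U s L = begin
  length (U ++ insertSorted s L)       ≡⟨ length-++ U ⟩
  length U + length (insertSorted s L) ≡⟨ cong (length U +_) (length-insertSorted s L) ⟩
  length U + suc (length L)            ≡⟨ +-suc (length U) (length L) ⟩
  suc (length U + length L)            ≡⟨ cong suc (length-++ U) ⟨
  suc (length (U ++ L))                ∎
  where open ≡-Reasoning

All-insertSorted : ∀ {P : ℕ → Set} {s} L → P s → All P L → All P (insertSorted s L)
All-insertSorted         []       Ps []          = Ps ∷ []
All-insertSorted {s = s} (b ∷ bs) Ps (Pb ∷ Pbs) with b <ᵇ s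
... | true  = Pb ∷ All-insertSorted bs Ps Pbs
... | false = Ps ∷ Pb ∷ Pbs

insertSorted-increasing : ∀ {s L} → Increasing L → s ∉ L → Increasing (insertSorted s L)
insertSorted-increasing             []           _  = [] ∷ []
insertSorted-increasing {s} {b ∷ bs} (b<bs ∷ bs↑) s∉ with b <ᵇ s | <ᵇ-reflects-< b s
... | true  | ofʸ b<s = All-insertSorted bs b<s b<bs ∷ insertSorted-increasing bs↑ (s∉ ∘ there)
... | false | ofⁿ b≮s = (s<b ∷ All.map (<-trans s<b) b<bs) ∷ b<bs ∷ bs↑
  where
  s<b : s < b
  s<b = ≤∧≢⇒< (≮⇒≥ b≮s) (s∉ ∘ here)

insertSorted-least : ∀ {s L} → All (s <_) L → insertSorted s L ≡ s ∷ L
insertSorted-least                []          = refl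
insertSorted-least {s} {b ∷ bs} (s<b ∷ _) rewrite <ᵇ-false (<⇒≯ s<b) = refl

insertSorted-++ : ∀ {s} P {L} → All (_< s) P → insertSorted s (P ++ L) ≡ P ++ insertSorted s L
insertSorted-++         []      []           = refl
insertSorted-++ {s} (p ∷ P) (p<s ∷ P<s) rewrite <ᵇ-true p<s = cong (p ∷_) (insertSorted-++ P P<s)

removeVal-⊆ : ∀ v U → removeVal v U ⊆ U
removeVal-⊆ v U = proj₁ ∘ ∈-filter⁻ (T? ∘ λ b → not (b ≡ᵇ v))

removeVal-increasing : ∀ v {U} → Increasing U → Increasing (removeVal v U)
removeVal-increasing v = AllPairsₚ.filter⁺ (T? ∘ λ b → not (b ≡ᵇ v))

removeVal-absent : ∀ {v} U → All (v <_) U → removeVal v U ≡ U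
removeVal-absent         []       []          = refl
removeVal-absent {v} (b ∷ bs) (v<b ∷ v<bs) rewrite ≡ᵇ-false (>⇒≢ v<b) = cong (b ∷_) (removeVal-absent bs v<bs)

removeVal-split : ∀ {v} P {U} → All (_< v) P → All (v <_) U → removeVal v (P ++ v ∷ U) ≡ P ++ U
removeVal-split {v} []      {U} []          v<U rewrite ≡ᵇ-true {v} refl = removeVal-absent U v<U
removeVal-split     (p ∷ P)     (p<v ∷ P<v) v<U rewrite ≡ᵇ-false (<⇒≢ p<v) = cong (p ∷_) (removeVal-split P P<v v<U)

removeVal-++-insertSorted-⊆ : ∀ v U {s} L → s ∈ U → removeVal v U ++ insertSorted s L ⊆ U ++ L
removeVal-++-insertSorted-⊆ v U L s∈U = All.lookup (All.++⁺
  (All.tabulate (∈-++⁺ˡ ∘ removeVal-⊆ v U))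
  (All-insertSorted L (∈-++⁺ˡ s∈U) (All.tabulate (∈-++⁺ʳ U))))

-- Greedy pairing

removeFirstGt-⊆ : ∀ d xs → removeFirstGt d xs ⊆ xs
removeFirstGt-⊆ d (b ∷ bs) y∈ with d <ᵇ b | y∈
... | true  | y∈′        = there y∈′
... | false | here refl  = here refl
... | false | there y∈′  = there (removeFirstGt-⊆ d bs y∈′)

removeFirstGt-increasing : ∀ d {xs} → Increasing xs → Increasing (removeFirstGt d xs)
removeFirstGt-increasing d []                      = []
removeFirstGt-increasing d {b ∷ bs} (b<bs ∷ bs↑) with d <ᵇ b
... | true  = bs↑
... | false = All.anti-mono (removeFirstGt-⊆ d bs) b<bs ∷ removeFirstGt-increasing d bs↑

removeFirstGt-keeps-≤ : ∀ d {xs x} → x ∈ xs → x ≤ d → x ∈ removeFirstGt d xs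
removeFirstGt-keeps-≤ d {b ∷ bs} (here refl) x≤d rewrite <ᵇ-false (≤⇒≯ x≤d) = here refl
removeFirstGt-keeps-≤ d {b ∷ bs} (there x∈) x≤d with d <ᵇ b
... | true  = x∈
... | false = there (removeFirstGt-keeps-≤ d x∈ x≤d)

removeFirstGt-keeps-> : ∀ d {xs y u} → Increasing xs → d < y → y ∈ xs → u ∈ xs → y < u →
                        u ∈ removeFirstGt d xs
removeFirstGt-keeps-> d {b ∷ bs} ↑@(_ ∷ bs↑) d<y y∈ u∈ y<u with d <ᵇ b | <ᵇ-reflects-< d b | u∈
... | true  | _        | here refl = ⊥-elim (<-irrefl refl (<-≤-trans y<u (Increasing-head≤ ↑ y∈)))
... | true  | _        | there u∈′ = u∈′
... | false | _        | here refl = here refl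
... | false | ofⁿ d≮b  | there u∈′ with y∈
...   | here refl = ⊥-elim (d≮b d<y)
...   | there y∈′ = there (removeFirstGt-keeps-> d bs↑ d<y y∈′ u∈′ y<u)

removeFirstGt-removes-suc : ∀ d {xs} → Increasing xs → suc d ∈ xs → suc d ∉ removeFirstGt d xs
removeFirstGt-removes-suc d {b ∷ bs} (b<bs ∷ bs↑) 1+d∈ ∈rem with d <ᵇ b | <ᵇ-reflects-< d b
... | true  | ofʸ d<b = <-irrefl refl (<-≤-trans (All.lookup b<bs ∈rem) d<b)
... | false | ofⁿ d≮b with ∈rem | 1+d∈
...   | here refl   | _           = d≮b ≤-refl
...   | there _     | here refl   = d≮b ≤-refl
...   | there ∈rem′ | there 1+d∈′ = removeFirstGt-removes-suc d bs↑ 1+d∈′ ∈rem′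

removeFirstGt-< : ∀ {c b} bs → c < b → removeFirstGt c (b ∷ bs) ≡ bs
removeFirstGt-< bs c<b rewrite <ᵇ-true c<b = refl

removeFirstGt-≮ : ∀ {c b} bs → c ≮ b → removeFirstGt c (b ∷ bs) ≡ b ∷ removeFirstGt c bs
removeFirstGt-≮ bs c≮b rewrite <ᵇ-false c≮b = refl

-- unpaired L U is definitionally pairOff (reverse L) U.
pairOff : List ℕ → List ℕ → List ℕ
pairOff ds avail = foldl (λ avail a → removeFirstGt a avail) avail ds

pairOff-⊆ : ∀ ds A → pairOff ds A ⊆ A
pairOff-⊆ []       A y∈ = y∈
pairOff-⊆ (d ∷ ds) A y∈ = removeFirstGt-⊆ d A (pairOff-⊆ ds (removeFirstGt d A) y∈)

pairOff-removes-suc : ∀ ds {A d} → Increasing A → d ∈ ds → suc d ∉ pairOff ds A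
pairOff-removes-suc (d ∷ ds) {A} A↑ (here refl) 1+d∈ =
  removeFirstGt-removes-suc d A↑ (pairOff-⊆ (d ∷ ds) A 1+d∈) (pairOff-⊆ ds (removeFirstGt d A) 1+d∈)
pairOff-removes-suc (d′ ∷ ds) A↑ (there d∈) =
  pairOff-removes-suc ds (removeFirstGt-increasing d′ A↑) d∈

-- Each d ∈ ds is paired with the least available letter above d: that letter is at most v when d < v,
-- it is d+1 < u when v ≤ d and d+1 < u, and it exceeds u when u ≤ d.
pairOff-keeps : ∀ ds {A u v} → Increasing A → Decreasing ds → u ∈ A → (∀ {a} → a ∈ ds → suc a ≢ u) →
  v ∈ pairOff ds A → v < u → (∀ {a} → a ∈ ds → v ≤ a → suc a < u → suc a ∈ A) → u ∈ pairOff ds A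
pairOff-keeps []       _  _             u∈ _ _ _ _ = u∈
pairOff-keeps (d ∷ ds) {A} {u} {v} A↑ (d>ds ∷ ds↓) u∈ u-1∉ v∈ v<u run =
  pairOff-keeps ds (removeFirstGt-increasing d A↑) ds↓ u∈′ (u-1∉ ∘ there) v∈ v<u run′
  where
  u∈′ : u ∈ removeFirstGt d A
  u∈′ with u ≤? d | d <? v
  ... | yes u≤d | _       = removeFirstGt-keeps-≤ d u∈ u≤d
  ... | no _    | yes d<v = removeFirstGt-keeps-> d A↑ d<v (pairOff-⊆ (d ∷ ds) A v∈) u∈ v<u
  ... | no u≰d  | no d≮v  = removeFirstGt-keeps-> d A↑ ≤-refl (run (here refl) (≮⇒≥ d≮v) 1+d<u) u∈ 1+d<u
    where
    1+d<u : suc d < u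
    1+d<u = ≤∧≢⇒< (≰⇒> u≰d) (u-1∉ (here refl))
  run′ : ∀ {a} → a ∈ ds → v ≤ a → suc a < u → suc a ∈ removeFirstGt d A
  run′ a∈ v≤a 1+a<u = removeFirstGt-keeps-≤ d (run (there a∈) v≤a 1+a<u) (All.lookup d>ds a∈)

data FirstGtView (c : ℕ) : List ℕ → Set where
  none : ∀ {A} → All (_≤ c) A → removeFirstGt c A ≡ A → FirstGtView c A
  some : ∀ P u Q → All (_≤ c) P → c < u → All (c <_) Q →
         removeFirstGt c (P ++ u ∷ Q) ≡ P ++ Q → FirstGtView c (P ++ u ∷ Q)

firstGtView : ∀ c {A} → Increasing A → FirstGtView c A
firstGtView c {[]}     []           = none [] refl
firstGtView c {b ∷ bs} (b<bs ∷ bs↑) with c <? b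
... | yes c<b = some [] b bs [] c<b (All.map (<-trans c<b) b<bs) (removeFirstGt-< bs c<b)
... | no c≮b with firstGtView c bs↑
...   | none bs≤c eq =
  none (≮⇒≥ c≮b ∷ bs≤c) (trans (removeFirstGt-≮ bs c≮b) (cong (b ∷_) eq))
...   | some P u Q P≤c c<u c<Q eq =
  some (b ∷ P) u Q (≮⇒≥ c≮b ∷ P≤c) c<u c<Q (trans (removeFirstGt-≮ (P ++ u ∷ Q) c≮b) (cong (b ∷_) eq))

-- Prefix _>_ U L: the j-th letter of U exceeds the j-th letter of L, for every j < length U.
Prefix-separated : ∀ {c U L} → All (c <_) U → All (_≤ c) L → length U ≤ length L → Prefix _>_ U L
Prefix-separated {U = []}                         _            _            _         = []
Prefix-separated {U = u ∷ U} {L = l ∷ L} (c<u ∷ c<U) (l≤c ∷ L≤c) (s≤s |U|≤|L|) =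
  ≤-<-trans l≤c c<u ∷ Prefix-separated c<U L≤c |U|≤|L|

Prefix-insert : ∀ {M} P {Q c u} → Prefix _>_ (P ++ Q) M → All (_< c) M → All (_≤ c) P → c < u →
                All (c <_) Q → Prefix _>_ (P ++ u ∷ Q) (M ∷ʳ c)
Prefix-insert     (p ∷ P) (m<p ∷ ≻) (_ ∷ M<c) (_ ∷ P≤c) c<u c<Q = m<p ∷ Prefix-insert P ≻ M<c P≤c c<u c<Q
Prefix-insert {M} []      {Q}       ≻ M<c []  c<u c<Q =
  Prefix-separated (c<u ∷ c<Q) (All.++⁺ (All.map <⇒≤ M<c) (≤-refl ∷ []))
    (subst (suc (length Q) ≤_) (sym (trans (length-++ M) (+-comm (length M) 1))) (s≤s (length-mono ≻)))

Prefix-removeFirstGt : ∀ {c M A} → All (_< c) M → FirstGtView c A →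
                       Prefix _>_ (removeFirstGt c A) M → Prefix _>_ A (M ∷ʳ c)
Prefix-removeFirstGt M<c (none _ eq) ≻ = subst (λ B → Prefix _>_ B _) eq ≻ ++ᵖ (_ ∷ [])
Prefix-removeFirstGt M<c (some P u Q P≤c c<u c<Q eq) ≻ =
  Prefix-insert P (subst (λ B → Prefix _>_ B _) eq ≻) M<c P≤c c<u c<Q

pairOff≡[]⇒Prefix : ∀ ds {A} → Increasing A → Decreasing ds → pairOff ds A ≡ [] → Prefix _>_ A (reverse ds)
pairOff≡[]⇒Prefix []           _  _            refl       = []
pairOff≡[]⇒Prefix (c ∷ ds) {A} A↑ (c>ds ∷ ds↓) all-paired rewrite unfold-reverse c ds =
  Prefix-removeFirstGt (All.tabulate (λ d∈ → All.lookup c>ds (Any.reverse⁻ d∈))) (firstGtView c A↑)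
    (pairOff≡[]⇒Prefix ds (removeFirstGt-increasing c A↑) ds↓ all-paired)

unpaired≡[]⇒Prefix : ∀ {L U} → Increasing L → Increasing U → unpaired L U ≡ [] → Prefix _>_ U L
unpaired≡[]⇒Prefix {L} L↑ U↑ all-paired =
  subst (Prefix _>_ _) (reverse-involutive L) (pairOff≡[]⇒Prefix (reverse L) U↑ (Increasing-reverse L↑) all-paired)

Prefix-nth : ∀ {R : ℕ → ℕ → Set} {U L} → Prefix R U L → ∀ j {b} → nth U j ≡ just b →
             ∃ λ a → nth L j ≡ just a × R b a
Prefix-nth (_∷_ {b = a} bRa _) zero    refl = a , refl , bRa
Prefix-nth (_ ∷ ≻)             (suc j) eq   = Prefix-nth ≻ j eq

maxMaybe≡nothing : ∀ xs → maxMaybe xs ≡ nothing → xs ≡ []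
maxMaybe≡nothing []       _  = refl
maxMaybe≡nothing (x ∷ xs) eq with maxMaybe xs
maxMaybe≡nothing (x ∷ xs) () | nothing
maxMaybe≡nothing (x ∷ xs) () | just _

maxMaybe≡just : ∀ xs {m} → maxMaybe xs ≡ just m → m ∈ xs × All (_≤ m) xs
maxMaybe≡just (x ∷ xs) eq with maxMaybe xs in eq′
maxMaybe≡just (x ∷ xs) refl | nothing rewrite maxMaybe≡nothing xs eq′ = here refl , ≤-refl ∷ []
maxMaybe≡just (x ∷ xs) refl | just m with maxMaybe≡just xs eq′ | m <ᵇ x | <ᵇ-reflects-< m x
... | m∈ , xs≤m | true  | ofʸ m<x = here refl , ≤-refl ∷ All.map (λ y≤m → <⇒≤ (≤-<-trans y≤m m<x)) xs≤m
... | m∈ , xs≤m | false | ofⁿ m≮x = there m∈ , ≮⇒≥ m≮x ∷ xs≤m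

-- The raising move

∈ᵇ-reflects-∈ : ∀ z bs → Reflects (z ∈ bs) (z ∈ᵇ bs)
∈ᵇ-reflects-∈ z []       = ofⁿ λ ()
∈ᵇ-reflects-∈ z (b ∷ bs) with b ≡ᵇ z | ≡ᵇ-reflects-≡ b z
... | true  | ofʸ refl = ofʸ (here refl)
... | false | ofⁿ b≢z  with z ∈ᵇ bs | ∈ᵇ-reflects-∈ z bs
...   | true  | ofʸ z∈ = ofʸ (there z∈)
...   | false | ofⁿ z∉ = ofⁿ λ { (here refl) → b≢z refl ; (there z∈) → z∉ z∈ }

climb-≥ : ∀ k bs z → z ≤ climb k bs z
climb-≥ zero    bs z = ≤-refl
climb-≥ (suc k) bs z with suc z ∈ᵇ bs
... | true  = <⇒≤ (climb-≥ k bs (suc z))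
... | false = ≤-refl

climb-∈ : ∀ k bs {z} → z ∈ bs → climb k bs z ∈ bs
climb-∈ zero    bs     z∈ = z∈
climb-∈ (suc k) bs {z} z∈ with suc z ∈ᵇ bs | ∈ᵇ-reflects-∈ (suc z) bs
... | true  | ofʸ 1+z∈ = climb-∈ k bs 1+z∈
... | false | _        = z∈

climb-run : ∀ k bs z {t} → z ≤ t → t < climb k bs z → suc t ∈ bs
climb-run zero    bs z z≤t t<z = ⊥-elim (<-irrefl refl (≤-<-trans z≤t t<z))
climb-run (suc k) bs z {t} z≤t t<c with suc z ∈ᵇ bs | ∈ᵇ-reflects-∈ (suc z) bs
... | false | _        = ⊥-elim (<-irrefl refl (≤-<-trans z≤t t<c))
... | true  | ofʸ 1+z∈ with z ≟ t
...   | yes refl = 1+z∈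
...   | no z≢t   = climb-run k bs (suc z) (≤∧≢⇒< z≤t z≢t) t<c

climb-stops : ∀ k bs z → suc (climb k bs z) ∉ bs ⊎ climb k bs z ≡ z + k
climb-stops zero    bs z = inj₂ (sym (+-identityʳ z))
climb-stops (suc k) bs z with suc z ∈ᵇ bs | ∈ᵇ-reflects-∈ (suc z) bs
... | false | ofⁿ 1+z∉ = inj₁ 1+z∉
... | true  | _ with climb-stops k bs (suc z)
...   | inj₁ stop = inj₁ stop
...   | inj₂ eq   = inj₂ (trans eq (sym (+-suc z k)))

run-length : ∀ {xs} z f → Increasing xs → (∀ t → t ≤ f → z + t ∈ xs) → f < length xs
run-length {[]}     z f _  run with run 0 z≤n
... | ()
run-length {b ∷ bs} z f ↑@(_ ∷ bs↑) run with b ≟ z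
... | no b≢z = m<n⇒m<1+n (run-length z f bs↑ (λ t t≤f → ∈-tail (run t t≤f) (z+t≢b t)))
  where
  b<z : b < z
  b<z = ≤∧≢⇒< (Increasing-head≤ ↑ (subst (_∈ b ∷ bs) (+-identityʳ z) (run 0 z≤n))) b≢z
  z+t≢b : ∀ t → z + t ≢ b
  z+t≢b t = >⇒≢ (<-≤-trans b<z (m≤m+n z t))
run-length {b ∷ bs} b zero    _      run | yes refl = s≤s z≤n
run-length {b ∷ bs} b (suc f) (_ ∷ bs↑) run | yes refl =
  s≤s (run-length (suc b) f bs↑ (λ t t≤f →
    ∈-tail (subst (_∈ b ∷ bs) (+-suc b t) (run (suc t) (s≤s t≤f))) (>⇒≢ (s≤s (m≤m+n b t)))))

-- The fuel length bs of climb never runs out: a run of consecutive letters of bs is shorter than bs.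
climb-stops-in : ∀ {bs z} → Increasing bs → z ∈ bs → suc (climb (length bs) bs z) ∉ bs
climb-stops-in {bs} {z} ↑ z∈ with climb-stops (length bs) bs z
... | inj₁ stop = stop
... | inj₂ eq   = ⊥-elim (<-irrefl refl (run-length z (length bs) ↑ run))
  where
  run : ∀ t → t ≤ length bs → z + t ∈ bs
  run zero    _       = subst (_∈ bs) (sym (+-identityʳ z)) z∈
  run (suc t) t<|bs| = subst (_∈ bs) (sym (+-suc z t))
    (climb-run (length bs) bs z (m≤m+n z t) (subst (z + t <_) (sym eq) (+-monoʳ-< z t<|bs|)))

-- v is the largest unpaired letter of U and s = min {z ≥ v : z+1 ∉ U}; gap says that v−1 ∉ L.
record RaisingSite (L U : List ℕ) (v s : ℕ) : Set where
  field
    v∈U   : v ∈ U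
    v≤s   : v ≤ s
    run∈U : ∀ {t} → v ≤ t → t < s → suc t ∈ U
    end∉U : suc s ∉ U
    run∈L : ∀ {t} → v ≤ t → t < s → t ∈ L
    gap   : ∀ {a} → a ∈ L → a < v → suc a < v

largestUnpaired⇒RaisingSite : ∀ {L U v} → Increasing L → Increasing U → maxMaybe (unpaired L U) ≡ just v →
                              RaisingSite L U v (climb (length U) U v)
largestUnpaired⇒RaisingSite {L} {U} {v} L↑ U↑ max≡v = record
  { v∈U = v∈U ; v≤s = climb-≥ (length U) U v ; run∈U = run∈U ; end∉U = climb-stops-in U↑ v∈U
  ; run∈L = run∈L ; gap = gap }
  where
  s : ℕ
  s = climb (length U) U v
  v-unpaired : v ∈ unpaired L U
  v-unpaired = proj₁ (maxMaybe≡just _ max≡v)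
  unpaired≤v : All (_≤ v) (unpaired L U)
  unpaired≤v = proj₂ (maxMaybe≡just _ max≡v)
  v∈U : v ∈ U
  v∈U = pairOff-⊆ (reverse L) U v-unpaired
  run∈U : ∀ {t} → v ≤ t → t < s → suc t ∈ U
  run∈U = climb-run (length U) U v
  run∈L : ∀ {t} → v ≤ t → t < s → t ∈ L
  run∈L {t} v≤t t<s with t ∈? L
  ... | yes t∈ = t∈
  ... | no  t∉ = ⊥-elim (<⇒≱ (s≤s v≤t) (All.lookup unpaired≤v 1+t-unpaired))
    where
    1+t-unpaired : suc t ∈ unpaired L U
    1+t-unpaired = pairOff-keeps (reverse L) U↑ (Increasing-reverse L↑) (run∈U v≤t t<s)
      (λ a∈ 1+a≡1+t → t∉ (subst (_∈ L) (suc-injective 1+a≡1+t) (Any.reverse⁻ a∈)))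
      v-unpaired (s≤s v≤t)
      (λ _ v≤a 1+a<1+t → run∈U v≤a (<-trans (≤-pred 1+a<1+t) t<s))
  gap : ∀ {a} → a ∈ L → a < v → suc a < v
  gap {a} a∈ a<v with suc a ≟ v
  ... | yes refl  = ⊥-elim (pairOff-removes-suc (reverse L) U↑ (Any.reverse⁺ a∈) v-unpaired)
  ... | no 1+a≢v = ≤∧≢⇒< a<v 1+a≢v

record Staircase (v s : ℕ) (U L : List ℕ) : Set where
  field
    v∷U↑  : Increasing (v ∷ U)
    L↑    : Increasing L
    v≤L   : All (v ≤_) L
    run∈U : ∀ {t} → v ≤ t → t < s → suc t ∈ U
    end∉U : suc s ∉ U
    run∈L : ∀ {t} → v ≤ t → t < s → t ∈ L

Staircase-peel : ∀ {v s U L} → v < s → Staircase v s U L →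
                 ∃₂ λ U′ L′ → U ≡ suc v ∷ U′ × L ≡ v ∷ L′ × Staircase (suc v) s U′ L′
Staircase-peel {v} {s} {U} {L} v<s st
  with least∈⇒head U (AllPairs.tail v∷U↑) (AllPairs.head v∷U↑) (run∈U ≤-refl v<s)
     | least∈⇒head L L↑ v≤L (run∈L ≤-refl v<s)
  where open Staircase st
... | U′ , refl | L′ , refl = U′ , L′ , refl , refl , record
  { v∷U↑  = AllPairs.tail v∷U↑
  ; L↑    = AllPairs.tail L↑
  ; v≤L   = AllPairs.head L↑
  ; run∈U = λ v<t t<s → ∈-tail (run∈U (<⇒≤ v<t) t<s) (>⇒≢ (s≤s v<t))
  ; end∉U = end∉U ∘ there
  ; run∈L = λ v<t t<s → ∈-tail (run∈L (<⇒≤ v<t) t<s) (>⇒≢ v<t)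
  }
  where open Staircase st

Staircase-distant : ∀ {v U L} → Staircase v v U L → All (Distant v) U
Staircase-distant {v} {U} st = All.tabulate λ u∈ →
  inj₁ (≤∧≢⇒< (All.lookup (AllPairs.head v∷U↑) u∈) (λ 1+v≡u → end∉U (subst (_∈ U) (sym 1+v≡u) u∈)))
  where open Staircase st

Staircase-distant-tail : ∀ {v s U L} → Staircase v s (suc v ∷ U) L → All (Distant v) U
Staircase-distant-tail st = All.map inj₁ (AllPairs.head (AllPairs.tail (Staircase.v∷U↑ st)))

-- (v ⋯ s)(v ⋯ s−1) = (v+1 ⋯ s)(v ⋯ s), one braid relation for each letter of the run.
staircase-raise : ∀ {v s U L} → v ≤‴ s → Staircase v s U L → s ∉ L → act (v ∷ U ++ L) ≗ act (U ++ insertSorted s L)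
staircase-raise {v} {U = U} {L} ≤‴-refl st v∉L x = begin
  swap v (act (U ++ L) x)          ≡⟨ act-++-∷ U L x (Staircase-distant st) ⟨
  act (U ++ v ∷ L) x               ≡⟨ cong (λ M → act (U ++ M) x) (insertSorted-least v<L) ⟨
  act (U ++ insertSorted v L) x    ∎
  where
  open ≡-Reasoning
  v<L : All (v <_) L
  v<L = All.tabulate λ t∈ → ≤∧≢⇒< (All.lookup (Staircase.v≤L st) t∈) (λ v≡t → v∉L (subst (_∈ L) (sym v≡t) t∈))
staircase-raise {v} {s} (≤‴-step 1+v≤‴s) st s∉L x with Staircase-peel (≤‴⇒≤ 1+v≤‴s) st
... | U′ , L′ , refl , refl , st′ = begin
  swap v (swap (suc v) (act (U′ ++ v ∷ L′) x))             ≡⟨ cong (swap v ∘ swap (suc v)) (act-++-∷ U′ L′ x U′⋯v) ⟩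
  swap v (swap (suc v) (swap v (act (U′ ++ L′) x)))        ≡⟨ swap-braid v (act (U′ ++ L′) x) ⟩
  swap (suc v) (swap v (swap (suc v) (act (U′ ++ L′) x)))  ≡⟨ cong (swap (suc v) ∘ swap v) (staircase-raise 1+v≤‴s st′ (s∉L ∘ there) x) ⟩
  swap (suc v) (swap v (act (U′ ++ insertSorted s L′) x))  ≡⟨ cong (swap (suc v)) (act-++-∷ U′ _ x U′⋯v) ⟨
  swap (suc v) (act (U′ ++ v ∷ insertSorted s L′) x)       ≡⟨ cong (λ M → swap (suc v) (act (U′ ++ M) x)) (insertSorted-++ (v ∷ []) (≤‴⇒≤ 1+v≤‴s ∷ [])) ⟨
  swap (suc v) (act (U′ ++ insertSorted s (v ∷ L′)) x)     ∎
  where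
  open ≡-Reasoning
  U′⋯v : All (Distant v) U′
  U′⋯v = Staircase-distant-tail st

-- (v ⋯ s)(v ⋯ s) = (v+1 ⋯ s)(v ⋯ s−1).
staircase-square : ∀ {v s U L} → v ≤‴ s → Staircase v s U L → s ∈ L → NonReduced (v ∷ U ++ L)
staircase-square {v} {U = U} ≤‴-refl st v∈L with least∈⇒head _ (Staircase.L↑ st) (Staircase.v≤L st) v∈L
... | L′ , refl = U ++ L′ , cancel , shorter
  where
  cancel : act (U ++ L′) ≗ act (v ∷ U ++ v ∷ L′)
  cancel x = begin
    act (U ++ L′) x                    ≡⟨ swap-involutive v _ ⟨
    swap v (swap v (act (U ++ L′) x))  ≡⟨ cong (swap v) (act-++-∷ U L′ x (Staircase-distant st)) ⟨
    swap v (act (U ++ v ∷ L′) x)       ∎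
    where open ≡-Reasoning
  shorter : length (U ++ L′) < suc (length (U ++ v ∷ L′))
  shorter = subst (length (U ++ L′) <_) (cong suc (sym (length-++-sucʳ U v L′))) (m<n⇒m<1+n (n<1+n _))
staircase-square {v} {s} (≤‴-step 1+v≤‴s) st s∈L with Staircase-peel (≤‴⇒≤ 1+v≤‴s) st
... | U′ , L′ , refl , refl , st′ with staircase-square 1+v≤‴s st′ (∈-tail s∈L (>⇒≢ (≤‴⇒≤ 1+v≤‴s)))
...   | Z , act≗ , shorter =
  suc v ∷ v ∷ Z , braid , s≤s (s≤s (subst (length Z <_) (sym (length-++-sucʳ U′ v L′)) shorter))
  where
  braid : act (suc v ∷ v ∷ Z) ≗ act (v ∷ suc v ∷ U′ ++ v ∷ L′)
  braid x = begin
    swap (suc v) (swap v (act Z x))                          ≡⟨ cong (swap (suc v) ∘ swap v) (act≗ x) ⟩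
    swap (suc v) (swap v (swap (suc v) (act (U′ ++ L′) x)))  ≡⟨ swap-braid v (act (U′ ++ L′) x) ⟨
    swap v (swap (suc v) (swap v (act (U′ ++ L′) x)))        ≡⟨ cong (swap v ∘ swap (suc v)) (act-++-∷ U′ L′ x (Staircase-distant-tail st)) ⟨
    swap v (swap (suc v) (act (U′ ++ v ∷ L′) x))             ∎
    where open ≡-Reasoning

RaisingSite⇒Staircase : ∀ Uᵃ {U₁ Lᵃ L₁ v s} → Increasing (Uᵃ ++ v ∷ U₁) → Increasing (Lᵃ ++ L₁) →
  All (_< v) Lᵃ → All (v ≤_) L₁ → RaisingSite (Lᵃ ++ L₁) (Uᵃ ++ v ∷ U₁) v s → Staircase v s U₁ L₁
RaisingSite⇒Staircase Uᵃ {Lᵃ = Lᵃ} U↑ L↑ Lᵃ<v v≤L₁ site = record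
  { v∷U↑  = Increasing-++⁻ʳ Uᵃ U↑
  ; L↑    = Increasing-++⁻ʳ Lᵃ L↑
  ; v≤L   = v≤L₁
  ; run∈U = λ v≤t t<s →
      ∈-tail (∈-++-≥ Uᵃ (proj₁ (Increasing-around Uᵃ U↑)) (m≤n⇒m≤1+n v≤t) (run∈U v≤t t<s)) (>⇒≢ (s≤s v≤t))
  ; end∉U = end∉U ∘ ∈-++⁺ʳ Uᵃ ∘ there
  ; run∈L = λ v≤t t<s → ∈-++-≥ Lᵃ Lᵃ<v v≤t (run∈L v≤t t<s)
  }
  where open RaisingSite site

data RaiseOutcome (L U : List ℕ) (v s : ℕ) : Set where
  shortens : NonReduced (U ++ L) → RaiseOutcome L U v s
  raises   : s ∉ L → removeVal v U ++ insertSorted s L ≃ U ++ L → RaiseOutcome L U v s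

-- The letters of L below v are at most v−2 (gap), so they commute with v and everything above it.
raiseOutcome : ∀ {L U v s} → Increasing L → Increasing U → RaisingSite L U v s → RaiseOutcome L U v s
raiseOutcome {v = v} {s} L↑ U↑ site with ∈-∃++ (RaisingSite.v∈U site) | splitBelow v L↑
... | Uᵃ , U₁ , refl | Lᵃ , L₁ , refl , Lᵃ<v , v≤L₁ = outcome
  where
  open RaisingSite site using (v≤s; gap)
  Uᵃ<v : All (_< v) Uᵃ
  Uᵃ<v = proj₁ (Increasing-around Uᵃ U↑)
  v<U₁ : All (v <_) U₁
  v<U₁ = proj₂ (Increasing-around Uᵃ U↑)
  staircase : Staircase v s U₁ L₁
  staircase = RaisingSite⇒Staircase Uᵃ U↑ L↑ Lᵃ<v v≤L₁ site
  Lᵃ-apart : ∀ {V} → All (v ≤_) V → All (λ b → All (Distant b) Lᵃ) V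
  Lᵃ-apart v≤V = Distant-blocks v≤V (All.tabulate λ a∈ → gap (∈-++⁺ˡ a∈) (All.lookup Lᵃ<v a∈))
  reorder : (Uᵃ ++ v ∷ U₁) ++ Lᵃ ++ L₁ ≃ Uᵃ ++ Lᵃ ++ v ∷ U₁ ++ L₁
  reorder = commute-blocks Uᵃ (v ∷ U₁) Lᵃ L₁ (Lᵃ-apart (≤-refl ∷ All.map <⇒≤ v<U₁))
  raised : s ∉ L₁ → removeVal v (Uᵃ ++ v ∷ U₁) ++ insertSorted s (Lᵃ ++ L₁) ≃ (Uᵃ ++ v ∷ U₁) ++ Lᵃ ++ L₁
  raised s∉L₁ rewrite removeVal-split Uᵃ Uᵃ<v v<U₁ | insertSorted-++ Lᵃ {L₁} (All.map (λ a<v → <-≤-trans a<v v≤s) Lᵃ<v) =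
    ≃-trans (commute-blocks Uᵃ U₁ Lᵃ (insertSorted s L₁) (Lᵃ-apart (All.map <⇒≤ v<U₁)))
   (≃-trans (≃-++ˡ Uᵃ (≃-++ˡ Lᵃ (mk≃ (sym ∘ staircase-raise (≤⇒≤‴ v≤s) staircase s∉L₁) (length-++-insertSorted U₁ s L₁))))
            (≃-sym reorder))
  outcome : RaiseOutcome (Lᵃ ++ L₁) (Uᵃ ++ v ∷ U₁) v s
  outcome with s ∈? L₁
  ... | yes s∈L₁ = shortens (NonReduced-≃ (≃-sym reorder)
                     (NonReduced-++ˡ Uᵃ (NonReduced-++ˡ Lᵃ (staircase-square (≤⇒≤‴ v≤s) staircase s∈L₁))))
  ... | no  s∉L₁ = raises (s∉L₁ ∘ ∈-++-≥ Lᵃ Lᵃ<v v≤s) (raised s∉L₁)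

-- Factorizations

wordOf-++ : ∀ xs ys → wordOf (xs ++ ys) ≡ wordOf ys ++ wordOf xs
wordOf-++ xs ys = trans (cong concat (reverse-++ xs ys)) (sym (concat-++ (reverse ys) (reverse xs)))

wordOf-adjacent : ∀ pre L U post → wordOf (pre ++ L ∷ U ∷ post) ≡ wordOf post ++ (U ++ L) ++ wordOf pre
wordOf-adjacent pre L U post = begin
  wordOf (pre ++ L ∷ U ∷ post)                  ≡⟨ wordOf-++ pre (L ∷ U ∷ post) ⟩
  wordOf (L ∷ U ∷ post) ++ wordOf pre           ≡⟨ cong (_++ wordOf pre) (wordOf-++ (L ∷ U ∷ []) post) ⟩
  (wordOf post ++ U ++ L ++ []) ++ wordOf pre   ≡⟨ cong (λ M → (wordOf post ++ U ++ M) ++ wordOf pre) (++-identityʳ L) ⟩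
  (wordOf post ++ U ++ L) ++ wordOf pre         ≡⟨ ++-assoc (wordOf post) (U ++ L) (wordOf pre) ⟩
  wordOf post ++ (U ++ L) ++ wordOf pre         ∎
  where open ≡-Reasoning

blk-∷ : ∀ B r i → blk (B ∷ r) (suc (suc i)) ≡ blk r (suc i)
blk-∷ B r i with nth r i
... | just _  = refl
... | nothing = refl

blk-lower : ∀ pre {L U post} → blk (pre ++ L ∷ U ∷ post) (suc (length pre)) ≡ L
blk-lower []                          = refl
blk-lower (B ∷ pre) {L} {U} {post} = trans (blk-∷ B (pre ++ L ∷ U ∷ post) (length pre)) (blk-lower pre)

blk-upper : ∀ pre {L U post} → blk (pre ++ L ∷ U ∷ post) (suc (suc (length pre))) ≡ U
blk-upper []                          = refl
blk-upper (B ∷ pre) {L} {U} {post} = trans (blk-∷ B (pre ++ L ∷ U ∷ post) (suc (length pre))) (blk-upper pre)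

-- Q i constrains block i+1.
blk-replace : ∀ (Q : ℕ → List ℕ → Set) pre {L U L′ U′ post} →
  (∀ i → Q i (blk (pre ++ L ∷ U ∷ post) (suc i))) → Q (length pre) L′ → Q (suc (length pre)) U′ →
  ∀ i → Q i (blk (pre ++ L′ ∷ U′ ∷ post) (suc i))
blk-replace Q []        old QL′ QU′ zero          = QL′
blk-replace Q []        old QL′ QU′ (suc zero)    = QU′
blk-replace Q [] {L} {U} {L′} {U′} {post} old QL′ QU′ (suc (suc i)) =
  subst (Q (suc (suc i))) (trans (blk-∷ L (U ∷ post) (suc i)) (trans (blk-∷ U post i)
    (sym (trans (blk-∷ L′ (U′ ∷ post) (suc i)) (blk-∷ U′ post i))))) (old (suc (suc i)))
blk-replace Q (B ∷ pre) old QL′ QU′ zero          = old zero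
blk-replace Q (B ∷ pre) {L} {U} {L′} {U′} {post} old QL′ QU′ (suc i) =
  subst (Q (suc i)) (sym (blk-∷ B (pre ++ L′ ∷ U′ ∷ post) i))
    (blk-replace (Q ∘ suc) pre (λ j → subst (Q (suc j)) (blk-∷ B (pre ++ L ∷ U ∷ post) j) (old (suc j))) QL′ QU′ i)

RFC⇒¬NonReduced : ∀ {n w} pre {L U} post → RFC n w (pre ++ L ∷ U ∷ post) → ¬ NonReduced (U ++ L)
RFC⇒¬NonReduced {n} {w} pre {L} {U} post (_ , _ , _ , reduced) nonReduced =
  ReducedWord⇒¬NonReduced (subst (ReducedWord n w) (wordOf-adjacent pre L U post) reduced)
    (NonReduced-++ˡ (wordOf post) (NonReduced-++ʳ {U ++ L} (wordOf pre) nonReduced))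

RFC-replace : ∀ {n w} pre {L U L′ U′} post → RFC n w (pre ++ L ∷ U ∷ post) →
  Increasing L′ → Increasing U′ → All (suc (length pre) ≤_) L′ → All (suc (suc (length pre)) ≤_) U′ →
  U′ ++ L′ ⊆ U ++ L → U′ ++ L′ ≃ U ++ L → RFC n w (pre ++ L′ ∷ U′ ∷ post)
RFC-replace {n} {w} pre {L} {U} {L′} {U′} post (length≡ , blocks↑ , flags , reduced) L′↑ U′↑ L′≥ U′≥ U′L′⊆UL U′L′≃UL =
  trans (trans (length-++ pre) (sym (length-++ pre))) length≡ , blocks↑′ , flags′ , reduced′
  where
  blocks↑′ : ∀ i → StrictlyIncreasing (blk (pre ++ L′ ∷ U′ ∷ post) i)
  blocks↑′ zero    = []
  blocks↑′ (suc i) = blk-replace (λ _ → StrictlyIncreasing) pre (blocks↑ ∘ suc)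
    (Increasing⇒StrictlyIncreasing L′ L′↑) (Increasing⇒StrictlyIncreasing U′ U′↑) i
  flags′ : ∀ i a → nth (blk (pre ++ L′ ∷ U′ ∷ post) i) 0 ≡ just a → i ≤ a
  flags′ zero    a ()
  flags′ (suc i) = blk-replace (λ i B → ∀ a → nth B 0 ≡ just a → suc i ≤ a) pre (flags ∘ suc)
    (All≥⇒head≥ L′≥) (All≥⇒head≥ U′≥) i
  reduced′ : ReducedWord n w (wordOf (pre ++ L′ ∷ U′ ∷ post))
  reduced′ = subst (ReducedWord n w) (sym (wordOf-adjacent pre L′ U′ post))
    (ReducedWord-≃ (subst (ReducedWord n w) (wordOf-adjacent pre L U post) reduced)
      (Subset.++⁺ʳ (wordOf post) (Subset.++⁺ˡ (wordOf pre) U′L′⊆UL))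
      (≃-++ˡ (wordOf post) (≃-++ʳ (wordOf pre) U′L′≃UL)))

setNth-adjacent : ∀ {A : Set} pre {L U L′ U′ : A} {post} →
  setNth (length pre) L′ (setNth (suc (length pre)) U′ (pre ++ L ∷ U ∷ post)) ≡ pre ++ L′ ∷ U′ ∷ post
setNth-adjacent []        = refl
setNth-adjacent (B ∷ pre) = cong (B ∷_) (setNth-adjacent pre)

raiseCand-just : ∀ r i {v} → maxMaybe (unpaired (blk r i) (blk r (suc i))) ≡ just v →
  raiseCand r i ≡ just (setNth (i ∸ 1) (insertSorted (climb (length (blk r (suc i))) (blk r (suc i)) v) (blk r i))
                               (setNth i (removeVal v (blk r (suc i))) r))
raiseCand-just r i max≡v with maxMaybe (unpaired (blk r i) (blk r (suc i)))
raiseCand-just r i refl | just _ = refl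

raiseCand-adjacent : ∀ pre {L U} post {v} → maxMaybe (unpaired L U) ≡ just v →
  raiseCand (pre ++ L ∷ U ∷ post) (suc (length pre)) ≡
  just (pre ++ insertSorted (climb (length U) U v) L ∷ removeVal v U ∷ post)
raiseCand-adjacent pre {L} {U} post {v} max≡v =
  trans (raiseCand-just r (suc (length pre)) (subst₂ (λ L U → maxMaybe (unpaired L U) ≡ just v) (sym lower) (sym upper) max≡v))
        (cong just (trans (cong₂ raised lower upper) (setNth-adjacent pre)))
  where
  r : Fact
  r = pre ++ L ∷ U ∷ post
  lower : blk r (suc (length pre)) ≡ L
  lower = blk-lower pre
  upper : blk r (suc (suc (length pre))) ≡ U
  upper = blk-upper pre
  raised : List ℕ → List ℕ → Fact
  raised L U = setNth (length pre) (insertSorted (climb (length U) U v) L) (setNth (suc (length pre)) (removeVal v U) r)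

raise-RFC : ∀ {n w} pre {L U} post {v} → RFC n w (pre ++ L ∷ U ∷ post) → maxMaybe (unpaired L U) ≡ just v →
  RFC n w (pre ++ insertSorted (climb (length U) U v) L ∷ removeVal v U ∷ post)
raise-RFC {n} {w} pre {L} {U} post {v} rfc@(_ , blocks↑ , flags , _) max≡v = raised (raiseOutcome L↑ U↑ site)
  where
  s : ℕ
  s = climb (length U) U v
  r : Fact
  r = pre ++ L ∷ U ∷ post
  block↑ : ∀ i {B} → blk r i ≡ B → Increasing B
  block↑ i eq = StrictlyIncreasing⇒Increasing (subst StrictlyIncreasing eq (blocks↑ i))
  block≥ : ∀ i {B} → blk r i ≡ B → Increasing B → All (i ≤_) B
  block≥ i eq B↑ = head≥⇒All≥ B↑ (subst (λ B → ∀ a → nth B 0 ≡ just a → i ≤ a) eq (flags i))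
  L↑ : Increasing L
  L↑ = block↑ _ (blk-lower pre)
  U↑ : Increasing U
  U↑ = block↑ _ (blk-upper pre)
  L≥ : All (suc (length pre) ≤_) L
  L≥ = block≥ _ (blk-lower pre) L↑
  U≥ : All (suc (suc (length pre)) ≤_) U
  U≥ = block≥ _ (blk-upper pre) U↑
  site : RaisingSite L U v s
  site = largestUnpaired⇒RaisingSite L↑ U↑ max≡v
  open RaisingSite site using (v∈U; v≤s)
  raised : RaiseOutcome L U v s → RFC n w (pre ++ insertSorted s L ∷ removeVal v U ∷ post)
  raised (shortens nonReduced) = ⊥-elim (RFC⇒¬NonReduced pre post rfc nonReduced)
  raised (raises s∉L U′L′≃UL) = RFC-replace pre post rfc
    (insertSorted-increasing L↑ s∉L) (removeVal-increasing v U↑)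
    (All-insertSorted L (≤-trans (n≤1+n _) (≤-trans (All.lookup U≥ v∈U) v≤s)) L≥)
    (All.anti-mono (removeVal-⊆ v U) U≥)
    (removeVal-++-insertSorted-⊆ v U L (climb-∈ (length U) U v∈U))
    U′L′≃UL

raiseNonzero : ∀ {n w} pre {L U} post {v} → RFC n w (pre ++ L ∷ U ∷ post) → maxMaybe (unpaired L U) ≡ just v →
  RaiseNonzero n w (pre ++ L ∷ U ∷ post) (suc (length pre))
raiseNonzero pre post rfc max≡v = _ , raiseCand-adjacent pre post max≡v , raise-RFC pre post rfc max≡v

adjacentBlocks : ∀ r i {v} → v ∈ blk r (suc (suc i)) →
  ∃₂ λ pre post → r ≡ pre ++ blk r (suc i) ∷ blk r (suc (suc i)) ∷ post × length pre ≡ i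
adjacentBlocks (B₁ ∷ B₂ ∷ r) zero    _  = [] , r , refl , refl
adjacentBlocks (B ∷ r)       (suc i) v∈ with adjacentBlocks r i (subst (_ ∈_) (blk-∷ B r (suc i)) v∈)
... | pre , post , r≡ , refl =
  B ∷ pre , post ,
  trans (cong (B ∷_) r≡) (cong₂ (λ L U → B ∷ pre ++ L ∷ U ∷ post) (sym (blk-∷ B r i)) (sym (blk-∷ B r (suc i)))) ,
  refl

HighestWeight⇒allPaired : ∀ {n w r} → RFC n w r → HighestWeight n w r →
  ∀ i → 1 ≤ i → i < n → unpaired (blk r i) (blk r (suc i)) ≡ []
HighestWeight⇒allPaired {n} {w} {r} rfc hw (suc i) 1≤i i<n
  with maxMaybe (unpaired (blk r (suc i)) (blk r (suc (suc i)))) in max≡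
... | nothing = maxMaybe≡nothing _ max≡
... | just v with adjacentBlocks r i (pairOff-⊆ (reverse (blk r (suc i))) _ (proj₁ (maxMaybe≡just _ max≡)))
...   | pre , post , r≡ , refl = ⊥-elim (hw (suc (length pre)) 1≤i i<n
          (subst (λ r → RaiseNonzero n w r (suc (length pre))) (sym r≡)
                 (raiseNonzero pre post (subst (RFC n w) r≡ rfc) max≡)))

HighestWeight⇒Prefix : ∀ {n w r} → RFC n w r → HighestWeight n w r →
  ∀ i → 1 ≤ i → i < n → Prefix _>_ (blk r (suc i)) (blk r i)
HighestWeight⇒Prefix rfc@(_ , blocks↑ , _) hw i 1≤i i<n =
  unpaired≡[]⇒Prefix (StrictlyIncreasing⇒Increasing (blocks↑ i)) (StrictlyIncreasing⇒Increasing (blocks↑ (suc i)))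
    (HighestWeight⇒allPaired rfc hw i 1≤i i<n)

Prefix-chain : ∀ (B : ℕ → List ℕ) {i k} → (∀ m → i ≤ m → m < k → Prefix _>_ (B (suc m)) (B m)) → i < k →
               ∀ j {a b} → nth (B i) j ≡ just a → nth (B k) j ≡ just b → a < b
Prefix-chain B {i} {suc k} step i<1+k j a≡ b≡ with Prefix-nth (step k (≤-pred i<1+k) ≤-refl) j b≡
... | c , c≡ , c<b with i ≟ k
...   | yes refl = subst (_< _) (just-injective (trans (sym c≡) a≡)) c<b
...   | no  i≢k  = <-trans (Prefix-chain B (λ m i≤m m<k → step m i≤m (m<n⇒m<1+n m<k))
                                         (≤∧≢⇒< (≤-pred i<1+k) i≢k) j a≡ c≡) c<b

lemma6p11 : (n : ℕ) (w : Permutation′ n) (r : Fact) → RFC n w r → HighestWeight n w r →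
    ∀ (j i k a b : ℕ) → 1 ≤ i → i < k → k ≤ n ∸ 1 →
      nth (blk r i) j ≡ just a → nth (blk r k) j ≡ just b → a < b
lemma6p11 n w r rfc hw j i k a b 1≤i i<k k≤n-1 =
  Prefix-chain (blk r) (λ m i≤m m<k → HighestWeight⇒Prefix rfc hw m (≤-trans 1≤i i≤m) (m<n m<k)) i<k j
  where
  m<n : ∀ {m} → m < k → m < n
  m<n m<k = <-≤-trans m<k (≤-trans k≤n-1 (m∸n≤m n 1))
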